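{- Let $n\ge 2$. For $v\in\mathbb{F}_q^n$ let $M_v$ be the $n\times\binom n2$ matrix over $\mathbb{F}_q$ whose $j$-th row is $X_{v,e_j}$ ($j=1,\dots,n$), and let $\mathbb{M}$ be the $\mathbb{F}_q$-linear span of $\{M_{e_1},\dots,M_{e_n}\}$. Then $|\mathbb{M}|=q^n$.
   Context: $e_j$ is the $j$-th unit vector of $\mathbb{F}_q^n$. For $v,u\in\mathbb{F}_q^n$, $X_{v,u}\in\mathbb{F}_q^{\binom n2}$ is the vector whose coordinate indexed by the $2$-subset $\{s,t\}$, $s<t$, of $\{1,\dots,n\}$ is $v_su_t-v_tu_s$. -}

module Defs where

open import Level using (Level; _⊔_)
open import Data.Nat using (ℕ; zero; suc)
open import Data.Fin using (Fin; _<_; _≟_)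
open import Data.Product using (Σ; ∃; _×_; _,_; proj₁; proj₂)
open import Relation.Nullary using (¬_; yes; no)
open import Relation.Binary.PropositionalEquality using (_≡_)
open import Algebra.Bundles using (CommutativeRing)

record IsField {c ℓ : Level} (R : CommutativeRing c ℓ) : Set (c ⊔ ℓ) where
  open CommutativeRing R
  field
    0≉1     : ¬ (0# ≈ 1#)
    inverse : ∀ x → ¬ (x ≈ 0#) → ∃ λ y → (x * y) ≈ 1#

record HasCard {a ℓ p : Level} (A : Set a) (_≈_ : A → A → Set ℓ)
               (P : A → Set p) (k : ℕ) : Set (a ⊔ ℓ ⊔ p) where
  field
    enum      : Fin k → A
    enum∈     : ∀ i → P (enum i)
    enum-inj  : ∀ i j → enum i ≈ enum j → i ≡ j
    enum-surj : ∀ x → P x → ∃ λ i → x ≈ enum i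

-- The 2-subsets {s,t}, s < t, of {1..n} (coordinates of F^(n choose 2)).
Pair : ℕ → Set
Pair n = Σ (Fin n × Fin n) λ st → proj₁ st < proj₂ st

module FieldDefs {c ℓ : Level} (R : CommutativeRing c ℓ) where
  open CommutativeRing R

  Vect : ℕ → Set c
  Vect n = Fin n → Carrier

  e : ∀ {n} → Fin n → Vect n
  e j i with i ≟ j
  ... | yes _ = 1#
  ... | no  _ = 0#

  X : ∀ {n} → Vect n → Vect n → Pair n → Carrier
  X v u ((s , t) , _) = (v s * u t) - (v t * u s)

  Mat : ℕ → Set c
  Mat n = Fin n → Pair n → Carrier

  M : ∀ {n} → Vect n → Mat n
  M v j = X v (e j)

  _≈M_ : ∀ {n} → Mat n → Mat n → Set ℓ
  A ≈M B = ∀ i p → A i p ≈ B i p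

  _+M_ : ∀ {n} → Mat n → Mat n → Mat n
  (A +M B) i p = A i p + B i p

  _·M_ : ∀ {n} → Carrier → Mat n → Mat n
  (a ·M A) i p = a * A i p

  0M : ∀ {n} → Mat n
  0M i p = 0#

  lincomb : ∀ {n m} → (Fin m → Carrier) → (Fin m → Mat n) → Mat n
  lincomb {m = zero}  c A = 0M
  lincomb {m = suc m} c A = (c Fin.zero ·M A Fin.zero) +M lincomb (λ k → c (Fin.suc k)) (λ k → A (Fin.suc k))
    where import Data.Fin as Fin

  InSpan : ∀ {n m} → (Fin m → Mat n) → Mat n → Set (c ⊔ ℓ)
  InSpan A B = ∃ λ (coef : Fin _ → Carrier) → B ≈M lincomb coef A

  𝕄 : ∀ n → Mat n → Set (c ⊔ ℓ)
  𝕄 n = InSpan (λ (j : Fin n) → M (e j))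

-- The map v ↦ M_v is linear, so a linear combination Σ_j c_j M_{e_j} is
-- simply M_c (lemma span-of-units, via the sifting identity
-- Σ_j c_j (e_j)_s = c_s).  Hence 𝕄 is exactly the image of v ↦ M_v.
-- For n ≥ 2 this map is injective: given a coordinate s, pick any t ≠ s;
-- the entry of M_v in row t and column {s,t} is ±v_s (lemmas
-- entry-below-diagonal / entry-above-diagonal).  So 𝕄 is in bijection
-- with F^n, which has q^n elements.
module Submission where

open import Defs
open import Level using (Level)
open import Data.Nat using (ℕ; _≤_; _^_; z≤n; s≤s)
open import Data.Fin using (Fin; zero; suc; _<_; _≟_; combine; remQuot)
open import Data.Fin.Properties using (remQuot-combine; combine-remQuot; suc-injective; <⇒≢)
open import Data.Product using (∃; _×_; _,_; proj₁; proj₂)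
open import Data.Unit using (⊤; tt)
open import Data.Empty using (⊥-elim)
open import Function using (_∘_)
open import Relation.Nullary using (yes; no)
open import Relation.Binary.PropositionalEquality as ≡ using (_≡_; _≢_)
open import Algebra.Bundles using (CommutativeRing)
import Algebra.Properties.Ring as RingProperties
import Algebra.Properties.Semiring.Sum as SemiringSum
import Relation.Binary.Reasoning.Setoid as SetoidReasoning

module Counting {a ℓ : Level} {A : Set a} {_≈_ : A → A → Set ℓ} where

  _≈ᵛ_ : ∀ {n} → (Fin n → A) → (Fin n → A) → Set ℓ
  u ≈ᵛ v = ∀ j → u j ≈ v j

  cons : ∀ {n} → A → (Fin n → A) → Fin (ℕ.suc n) → A
  cons x v zero    = x
  cons x v (suc j) = v j

  vector-card : ∀ {q} → HasCard A _≈_ (λ _ → ⊤) q →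
                ∀ n → HasCard (Fin n → A) _≈ᵛ_ (λ _ → ⊤) (q ^ n)
  vector-card {q} H n = record
    { enum = enumᵛ n ; enum∈ = λ _ → tt ; enum-inj = enumᵛ-inj n ; enum-surj = λ v _ → enumᵛ-surj n v }
    where
    open HasCard H

    split-index : ∀ n → Fin (q ^ ℕ.suc n) → Fin q × Fin (q ^ n)
    split-index n = remQuot {q} (q ^ n)

    enumᵛ : ∀ n → Fin (q ^ n) → Fin n → A
    enumᵛ ℕ.zero    i ()
    enumᵛ (ℕ.suc n) i = cons (enum (proj₁ (split-index n i))) (enumᵛ n (proj₂ (split-index n i)))

    enumᵛ-inj : ∀ n i i′ → enumᵛ n i ≈ᵛ enumᵛ n i′ → i ≡ i′
    enumᵛ-inj ℕ.zero    zero zero _ = ≡.refl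
    enumᵛ-inj (ℕ.suc n) i i′ h = begin
      i                                                             ≡⟨ combine-remQuot {q} (q ^ n) i ⟨
      combine (proj₁ (split-index n i)) (proj₂ (split-index n i))   ≡⟨ ≡.cong₂ combine (enum-inj _ _ (h zero)) (enumᵛ-inj n _ _ (h ∘ suc)) ⟩
      combine (proj₁ (split-index n i′)) (proj₂ (split-index n i′)) ≡⟨ combine-remQuot {q} (q ^ n) i′ ⟩
      i′                                                            ∎
      where open ≡.≡-Reasoning

    enumᵛ-surj : ∀ n (v : Fin n → A) → ∃ λ i → v ≈ᵛ enumᵛ n i
    enumᵛ-surj ℕ.zero    v = zero , λ ()
    enumᵛ-surj (ℕ.suc n) v with enum-surj (v zero) tt | enumᵛ-surj n (v ∘ suc)
    ... | x , v₀≈x | w , tail≈w = combine x w , covers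
      where
      split : v ≈ᵛ cons (enum x) (enumᵛ n w)
      split zero    = v₀≈x
      split (suc j) = tail≈w j

      covers : v ≈ᵛ enumᵛ (ℕ.suc n) (combine x w)
      covers j = ≡.subst (λ r → v j ≈ cons (enum (proj₁ r)) (enumᵛ n (proj₂ r)) j)
                         (≡.sym (remQuot-combine {q} {q ^ n} x w)) (split j)

  card-image : ∀ {b ℓ′ p k} {B : Set b} {_≈ᴮ_ : B → B → Set ℓ′} {P : B → Set p} →
               HasCard A _≈_ (λ _ → ⊤) k → (f : A → B) →
               (∀ {x y} → x ≈ y → f x ≈ᴮ f y) → (∀ {x y} → f x ≈ᴮ f y → x ≈ y) →
               (∀ {x y z} → x ≈ᴮ y → y ≈ᴮ z → x ≈ᴮ z) →
               (∀ x → P (f x)) → (∀ y → P y → ∃ λ x → y ≈ᴮ f x) →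
               HasCard B _≈ᴮ_ P k
  card-image H f f-resp f-refl ≈ᴮ-trans in-image covered = record
    { enum      = f ∘ enum
    ; enum∈     = in-image ∘ enum
    ; enum-inj  = λ i j → enum-inj i j ∘ f-refl
    ; enum-surj = λ y Py → let (x , y≈fx) = covered y Py
                               (i , x≈i)  = enum-surj x tt
                           in i , ≈ᴮ-trans y≈fx (f-resp x≈i)
    }
    where open HasCard H

module Matrices {c ℓ : Level} (R : CommutativeRing c ℓ) where
  open CommutativeRing R hiding (zero)
  open FieldDefs R
  open RingProperties ring using (-0#≈0#; -‿injective; -‿distribʳ-*)
  open SemiringSum semiring using (sum; sum-cong-≋; sum-replicate-zero; ∑-distrib-+; *-distribʳ-sum)
  open SetoidReasoning setoid

  e-diagonal : ∀ {n} (t : Fin n) → e t t ≈ 1#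
  e-diagonal t with t ≟ t
  ... | yes _ = refl
  ... | no t≢t = ⊥-elim (t≢t ≡.refl)

  e-off-diagonal : ∀ {n} {s t : Fin n} → s ≢ t → e t s ≈ 0#
  e-off-diagonal {s = s} {t} s≢t with s ≟ t
  ... | yes s≡t = ⊥-elim (s≢t s≡t)
  ... | no _    = refl

  sum-single : ∀ {n} (g : Fin n → Carrier) s → (∀ j → j ≢ s → g j ≈ 0#) → sum g ≈ g s
  sum-single {ℕ.suc n} g zero vanish = begin
    g zero + sum (g ∘ suc)      ≈⟨ +-congˡ (sum-cong-≋ {n} (λ j → vanish (suc j) λ ())) ⟩
    g zero + sum {n} (λ _ → 0#) ≈⟨ +-congˡ (sum-replicate-zero n) ⟩
    g zero + 0#                 ≈⟨ +-identityʳ _ ⟩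
    g zero                      ∎
  sum-single g (suc s) vanish = begin
    g zero + sum (g ∘ suc) ≈⟨ +-cong (vanish zero λ ()) (sum-single (g ∘ suc) s (λ j j≢s → vanish (suc j) (j≢s ∘ suc-injective))) ⟩
    0# + g (suc s)         ≈⟨ +-identityˡ _ ⟩
    g (suc s)              ∎

  sift : ∀ {n} (v : Vect n) s → sum (λ j → v j * e j s) ≈ v s
  sift v s = trans (sum-single _ s (λ j j≢s → trans (*-congˡ (e-off-diagonal (j≢s ∘ ≡.sym))) (zeroʳ _)))
                   (trans (*-congˡ (e-diagonal s)) (*-identityʳ _))

  lincomb-entry : ∀ {n m} (v : Fin m → Carrier) (A : Fin m → Mat n) i p →
                  lincomb v A i p ≈ sum (λ j → v j * A j i p)
  lincomb-entry {m = ℕ.zero}  v A i p = refl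
  lincomb-entry {m = ℕ.suc m} v A i p = +-congˡ (lincomb-entry (v ∘ suc) (A ∘ suc) i p)

  split-term : ∀ w a b x y → w * (a * x - b * y) ≈ (w * a) * x + (w * b) * (- y)
  split-term w a b x y = begin
    w * (a * x - b * y)           ≈⟨ distribˡ w (a * x) (- (b * y)) ⟩
    w * (a * x) + w * - (b * y)   ≈⟨ +-cong (sym (*-assoc w a x)) (*-congˡ (-‿distribʳ-* b y)) ⟩
    (w * a) * x + w * (b * - y)   ≈⟨ +-congˡ (sym (*-assoc w b (- y))) ⟩
    (w * a) * x + (w * b) * (- y) ∎

  span-of-units : ∀ {n} (v : Vect n) → lincomb v (λ j → M (e j)) ≈M M v
  span-of-units v i ((s , t) , _) = begin
    lincomb v (λ j → M (e j)) i ((s , t) , _)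
      ≈⟨ lincomb-entry v (λ j → M (e j)) i _ ⟩
    sum (λ j → v j * (e j s * e i t - e j t * e i s))
      ≈⟨ sum-cong-≋ (λ j → split-term (v j) (e j s) (e j t) (e i t) (e i s)) ⟩
    sum (λ j → (v j * e j s) * e i t + (v j * e j t) * (- e i s))
      ≈⟨ ∑-distrib-+ (λ j → (v j * e j s) * e i t) (λ j → (v j * e j t) * (- e i s)) ⟩
    sum (λ j → (v j * e j s) * e i t) + sum (λ j → (v j * e j t) * (- e i s))
      ≈⟨ +-cong (*-distribʳ-sum (e i t) (λ j → v j * e j s)) (*-distribʳ-sum (- e i s) (λ j → v j * e j t)) ⟨
    sum (λ j → v j * e j s) * e i t + sum (λ j → v j * e j t) * (- e i s)
      ≈⟨ +-cong (*-congʳ (sift v s)) (*-congʳ (sift v t)) ⟩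
    v s * e i t + v t * (- e i s)
      ≈⟨ +-congˡ (-‿distribʳ-* (v t) (e i s)) ⟨
    v s * e i t - v t * e i s
      ∎

  M∈𝕄 : ∀ {n} (v : Vect n) → 𝕄 n (M v)
  M∈𝕄 v = v , λ i p → sym (span-of-units v i p)

  𝕄⊆image : ∀ {n} (B : Mat n) → 𝕄 n B → ∃ λ v → B ≈M M v
  𝕄⊆image B (v , B≈comb) = v , λ i p → trans (B≈comb i p) (span-of-units v i p)

  M-cong : ∀ {n} {u v : Vect n} → (∀ j → u j ≈ v j) → M u ≈M M v
  M-cong u≈v i ((s , t) , _) = +-cong (*-congʳ (u≈v s)) (-‿cong (*-congʳ (u≈v t)))

  ≈M-trans : ∀ {n} {A B C : Mat n} → A ≈M B → B ≈M C → A ≈M C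
  ≈M-trans A≈B B≈C i p = trans (A≈B i p) (B≈C i p)

  entry-below-diagonal : ∀ {n} (v : Vect n) {s t} (s<t : s < t) → M v t ((s , t) , s<t) ≈ v s
  entry-below-diagonal v {s} {t} s<t = begin
    v s * e t t - v t * e t s ≈⟨ +-cong (*-congˡ (e-diagonal t)) (-‿cong (*-congˡ (e-off-diagonal (<⇒≢ s<t)))) ⟩
    v s * 1# - v t * 0#       ≈⟨ +-cong (*-identityʳ _) (trans (-‿cong (zeroʳ _)) -0#≈0#) ⟩
    v s + 0#                  ≈⟨ +-identityʳ _ ⟩
    v s                       ∎

  entry-above-diagonal : ∀ {n} (v : Vect n) {s t} (t<s : t < s) → M v t ((t , s) , t<s) ≈ - v s
  entry-above-diagonal v {s} {t} t<s = begin
    v t * e t s - v s * e t t ≈⟨ +-cong (*-congˡ (e-off-diagonal (<⇒≢ t<s ∘ ≡.sym))) (-‿cong (*-congˡ (e-diagonal t))) ⟩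
    v t * 0# - v s * 1#       ≈⟨ +-cong (zeroʳ _) (-‿cong (*-identityʳ _)) ⟩
    0# - v s                  ≈⟨ +-identityˡ _ ⟩
    - v s                     ∎

  -- For n ≥ 2 the map v ↦ M_v is injective: compare v_s with a second
  -- coordinate t (t = 1 if s = 0, and t = 0 otherwise).
  M-injective : ∀ {n} → 2 ≤ n → {u v : Vect n} → M u ≈M M v → ∀ s → u s ≈ v s
  M-injective {ℕ.suc (ℕ.suc m)} (s≤s (s≤s z≤n)) {u} {v} Mu≈Mv zero = begin
    u zero        ≈⟨ entry-below-diagonal u 0<1 ⟨
    M u one col₀₁ ≈⟨ Mu≈Mv one col₀₁ ⟩
    M v one col₀₁ ≈⟨ entry-below-diagonal v 0<1 ⟩
    v zero        ∎
    where
    one : Fin (ℕ.suc (ℕ.suc m))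
    one = suc zero
    0<1 : zero {ℕ.suc m} < one
    0<1 = s≤s z≤n
    col₀₁ : Pair (ℕ.suc (ℕ.suc m))
    col₀₁ = (zero , one) , 0<1
  M-injective {ℕ.suc (ℕ.suc m)} (s≤s (s≤s z≤n)) {u} {v} Mu≈Mv (suc s) = -‿injective (begin
    - u (suc s)    ≈⟨ entry-above-diagonal u 0<s ⟨
    M u zero col₀ₛ ≈⟨ Mu≈Mv zero col₀ₛ ⟩
    M v zero col₀ₛ ≈⟨ entry-above-diagonal v 0<s ⟩
    - v (suc s)    ∎)
    where
    0<s : zero {ℕ.suc m} < suc s
    0<s = s≤s z≤n
    col₀ₛ : Pair (ℕ.suc (ℕ.suc m))
    col₀ₛ = (zero , suc s) , 0<s

corollary5 : {c ℓ : Level} (F : CommutativeRing c ℓ) → IsField F →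
             (q : ℕ) → HasCard (CommutativeRing.Carrier F) (CommutativeRing._≈_ F) (λ _ → ⊤) q →
             (n : ℕ) → 2 ≤ n →
             HasCard (FieldDefs.Mat F n) (FieldDefs._≈M_ F) (FieldDefs.𝕄 F n) (q ^ n)
corollary5 F _ q card-F n 2≤n =
  card-image (vector-card card-F n) M M-cong (M-injective 2≤n) ≈M-trans M∈𝕄 𝕄⊆image
  where
  open Counting
  open FieldDefs F using (M)
  open Matrices F
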